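{- Let $w$ be an indeterminate. For $n\in\mathbb N$ let $S(n)\in\mathbb N[w]$ be the sum, over all subsequences of the binary expansion of $n$ of the form $1(01)^j$ ($j\geq 0$), of the weights $w^j$; and let $S_e(n)\in\mathbb N[w]$ be the sum, over all subsequences of the binary expansion of $n$ of the form $(10)^j$ ($j\geq0$, the empty subsequence included), of the weights $w^j$. Then: (i) $S(n)$ evaluated at $w=1$ equals the Stern number $s(n)$ for all $n$. (ii) The sequences $S$ and $S_e$ are uniquely determined by $S(0)=0$, $S(1)=S_e(0)=S_e(1)=1$ and $$S(2n)=S(n),\quad S(2n+1)=S(n)+S_e(n),\quad S_e(2n)=wS(n)+S_e(n),\quad S_e(2n+1)=S_e(n).$$ (iii) The sequence $S$ is also uniquely determined by $S(0)=0$, $S(1)=1$ and $$S(2n)=S(n),\quad S(4n+1)=wS(2n)+S(2n+1),\quad S(4n-1)=S(2n-1)+S(2m+1)+(w-1)S(2m),$$ where in the last formula $n=2^a(2m+1)$ with $a,m\in\mathbb N$.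
   Context: The Stern sequence $s$ is defined by $s(0)=0$, $s(1)=1$, $s(2n)=s(n)$, $s(2n+1)=s(n)+s(n+1)$ for $n\geq1$. The binary expansion of $n$ is written without leading zeros (that of $0$ being empty). Subsequences are given by sets of positions in the binary expansion, read in order; distinct position sets count separately. -}

module Defs where

open import Data.Nat using (ℕ; zero; suc; _+_; _*_; _∸_; _^_; _%_; _≡ᵇ_; ⌊_/2⌋)
open import Data.Bool using (Bool; true; false; if_then_else_)
open import Data.Bool.Properties using () renaming (_≟_ to _≟ᵇ_)
open import Data.List using (List; []; _∷_; _++_; [_]; map; upTo; length; concat; replicate)
open import Data.Nat.ListAction using (sum)
open import Data.Integer using (ℤ) renaming (_+_ to _+ℤ_; -_ to -ℤ_; +_ to ℤ+)
open import Data.Product using (_×_)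
open import Relation.Nullary using (does)
open import Relation.Binary.PropositionalEquality using (_≡_)

-- Binary expansion (most significant bit first, no leading zeros;
-- the expansion of 0 is empty).  true = 1, false = 0.

binaryF : ℕ → ℕ → List Bool
binaryF zero    _ = []
binaryF (suc f) zero = []
binaryF (suc f) n@(suc _) = binaryF f ⌊ n /2⌋ ++ [ n % 2 ≡ᵇ 1 ]

binary : ℕ → List Bool
binary n = binaryF n n

-- Number of occurrences of a pattern as a subsequence of a word,
-- i.e. the number of position sets (read in order) spelling the pattern.

occ : List Bool → List Bool → ℕ
occ []       _        = 1
occ (p ∷ ps) []       = 0
occ (p ∷ ps) (x ∷ xs) =
  (if does (p ≟ᵇ x) then occ ps xs else 0) + occ (p ∷ ps) xs

patS : ℕ → List Bool
patS j = true ∷ concat (replicate j (false ∷ true ∷ []))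

patE : ℕ → List Bool
patE j = concat (replicate j (true ∷ false ∷ []))

-- Polynomials in ℕ[w] (resp. ℤ[w]) as coefficient lists, constant term
-- first; two lists denote the same polynomial iff all coefficients agree
-- (trailing zeros are irrelevant).

Poly : Set
Poly = List ℕ

coeff : Poly → ℕ → ℕ
coeff []      _       = 0
coeff (a ∷ p) zero    = a
coeff (a ∷ p) (suc j) = coeff p j

infix 4 _≈_
_≈_ : Poly → Poly → Set
p ≈ q = ∀ j → coeff p j ≡ coeff q j

infixl 6 _⊕_
_⊕_ : Poly → Poly → Poly
[]      ⊕ q       = q
(a ∷ p) ⊕ []      = a ∷ p
(a ∷ p) ⊕ (b ∷ q) = (a + b) ∷ (p ⊕ q)

w· : Poly → Poly
w· p = 0 ∷ p

eval1 : Poly → ℕ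
eval1 p = sum p

PolyZ : Set
PolyZ = List ℤ

coeffZ : PolyZ → ℕ → ℤ
coeffZ []      _       = ℤ+ 0
coeffZ (a ∷ p) zero    = a
coeffZ (a ∷ p) (suc j) = coeffZ p j

infix 4 _≈ᶻ_
_≈ᶻ_ : PolyZ → PolyZ → Set
p ≈ᶻ q = ∀ j → coeffZ p j ≡ coeffZ q j

infixl 6 _⊕ᶻ_
_⊕ᶻ_ : PolyZ → PolyZ → PolyZ
[]      ⊕ᶻ q       = q
(a ∷ p) ⊕ᶻ []      = a ∷ p
(a ∷ p) ⊕ᶻ (b ∷ q) = (a +ℤ b) ∷ (p ⊕ᶻ q)

negᶻ : PolyZ → PolyZ
negᶻ = map -ℤ_

toZ : Poly → PolyZ
toZ = map ℤ+

[w-1]· : PolyZ → PolyZ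
[w-1]· p = (ℤ+ 0 ∷ p) ⊕ᶻ negᶻ p

-- Coefficients
-- of index > length (binary n) vanish, so the lists below are the full
-- polynomials.

S : ℕ → Poly
S n = map (λ j → occ (patS j) (binary n)) (upTo (suc (length (binary n))))

Se : ℕ → Poly
Se n = map (λ j → occ (patE j) (binary n)) (upTo (suc (length (binary n))))

IsStern : (ℕ → ℕ) → Set
IsStern s = (s 0 ≡ 0) × (s 1 ≡ 1)
          × (∀ n → 1 Data.Nat.≤ n → s (2 * n) ≡ s n)
          × (∀ n → 1 Data.Nat.≤ n → s (2 * n + 1) ≡ s n + s (n + 1))

Rec2 : (ℕ → Poly) → (ℕ → Poly) → Set
Rec2 T Te = (T 0 ≈ []) × (T 1 ≈ 1 ∷ []) × (Te 0 ≈ 1 ∷ []) × (Te 1 ≈ 1 ∷ [])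
          × (∀ n → T (2 * n) ≈ T n)
          × (∀ n → T (2 * n + 1) ≈ T n ⊕ Te n)
          × (∀ n → Te (2 * n) ≈ w· (T n) ⊕ Te n)
          × (∀ n → Te (2 * n + 1) ≈ Te n)

Rec3 : (ℕ → Poly) → Set
Rec3 T = (T 0 ≈ []) × (T 1 ≈ 1 ∷ [])
       × (∀ n → T (2 * n) ≈ T n)
       × (∀ n → T (4 * n + 1) ≈ w· (T (2 * n)) ⊕ T (2 * n + 1))
       × (∀ n a m → n ≡ 2 ^ a * (2 * m + 1) →
            toZ (T (4 * n ∸ 1))
              ≈ᶻ toZ (T (2 * n ∸ 1)) ⊕ᶻ toZ (T (2 * m + 1)) ⊕ᶻ [w-1]· (toZ (T (2 * m))))

-- Appending a letter x to a word changes subsequence counts simply: an occurrence of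
-- p ∷ʳ c in xs ∷ʳ x either uses the final x (possible only when x = c) or lies in xs.
-- Since 1(01)^j = (10)^j 1 and (10)^(j+1) = 1(01)^j 0, reading the binary expansion of n
-- bit by bit yields the system (ii), and induction along binary expansions shows that it
-- has only one solution.  At w = 1 the system becomes the Stern recursion for the pair
-- (s(n), s(n+1)), which gives (i).  For (iii), 4n - 1 = 2(2n - 1) + 1 and the expansion
-- of 2n - 1 is that of 2m followed by ones, so S_e(2n - 1) = S_e(2m) = w S(m) + S_e(m);
-- together with S(2m + 1) = S(m) + S_e(m) this is the stated formula, whose right-hand
-- side involves only smaller arguments, so strong induction gives uniqueness.
module Submission where

open import Defs
open import Data.Bool using (Bool; true; false; if_then_else_)
open import Data.Bool.Properties using () renaming (_≟_ to _≟ᵇ_)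
import Data.Integer as ℤ
import Data.Integer.Properties as ℤₚ
import Data.Integer.Tactic.RingSolver as ℤ-Solver
open import Data.List using (List; []; _∷_; _∷ʳ_; [_]; length; map; upTo; applyUpTo)
open import Data.List.Properties using (map-upTo)
open import Data.Nat using (ℕ; zero; suc; _+_; _*_; _∸_; _^_; _%_; _≡ᵇ_; ⌊_/2⌋; _≤_; _<_; z≤n; s≤s; s≤s⁻¹; z<s; NonZero)
open import Data.Nat.DivMod using ([m+kn]%n≡m%n; m*n%n≡0)
open import Data.Nat.Induction using (<-rec)
open import Data.Nat.ListAction using (sum)
open import Data.Nat.Properties
open import Algebra.Properties.CommutativeSemigroup +-commutativeSemigroup using (x∙yz≈y∙xz; interchange)
open import Data.Nat.Tactic.RingSolver using (solve-∀)
open import Data.Product as Product using (_×_; _,_; proj₁; ∃₂)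
open import Data.Sum using (inj₁; inj₂)
open import Function using (_∘_)
open import Level using (0ℓ)
open import Relation.Binary using (Setoid)
import Relation.Binary.Reasoning.Setoid as SetoidReasoning
open import Relation.Nullary using (does)
open import Relation.Binary.PropositionalEquality hiding ([_])

-- Counting subsequences

δ : Bool → Bool → ℕ
δ p x = if does (p ≟ᵇ x) then 1 else 0

occ-∷-∷ : ∀ p ps x xs → occ (p ∷ ps) (x ∷ xs) ≡ δ p x * occ ps xs + occ (p ∷ ps) xs
occ-∷-∷ true  ps true  xs = cong (_+ occ (true ∷ ps) xs) (sym (*-identityˡ (occ ps xs)))
occ-∷-∷ true  ps false xs = refl
occ-∷-∷ false ps true  xs = refl
occ-∷-∷ false ps false xs = cong (_+ occ (false ∷ ps) xs) (sym (*-identityˡ (occ ps xs)))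

occ-∷ʳ-[] : ∀ p c → occ (p ∷ʳ c) [] ≡ 0
occ-∷ʳ-[] []      c = refl
occ-∷ʳ-[] (_ ∷ _) c = refl

occ-∷ʳ-∷ʳ : ∀ p c xs x → occ (p ∷ʳ c) (xs ∷ʳ x) ≡ δ c x * occ p xs + occ (p ∷ʳ c) xs
occ-∷ʳ-∷ʳ []       c []       x = occ-∷-∷ c [] x []
occ-∷ʳ-∷ʳ (q ∷ qs) c []       x
  rewrite occ-∷-∷ q (qs ∷ʳ c) x [] | occ-∷ʳ-[] qs c | *-zeroʳ (δ q x) | *-zeroʳ (δ c x) = refl
occ-∷ʳ-∷ʳ []       c (y ∷ ys) x = begin
  occ [ c ] (y ∷ ys ∷ʳ x)                 ≡⟨ occ-∷-∷ c [] y (ys ∷ʳ x) ⟩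
  δ c y * 1 + occ [ c ] (ys ∷ʳ x)         ≡⟨ cong (δ c y * 1 +_) (occ-∷ʳ-∷ʳ [] c ys x) ⟩
  δ c y * 1 + (δ c x * 1 + occ [ c ] ys)  ≡⟨ x∙yz≈y∙xz (δ c y * 1) (δ c x * 1) (occ [ c ] ys) ⟩
  δ c x * 1 + (δ c y * 1 + occ [ c ] ys)  ≡⟨ cong (δ c x * 1 +_) (occ-∷-∷ c [] y ys) ⟨
  δ c x * 1 + occ [ c ] (y ∷ ys)          ∎
  where open ≡-Reasoning
occ-∷ʳ-∷ʳ (q ∷ qs) c (y ∷ ys) x = begin
  occ (q ∷ qs ∷ʳ c) (y ∷ ys ∷ʳ x)
    ≡⟨ occ-∷-∷ q (qs ∷ʳ c) y (ys ∷ʳ x) ⟩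
  δ q y * occ (qs ∷ʳ c) (ys ∷ʳ x) + occ (q ∷ qs ∷ʳ c) (ys ∷ʳ x)
    ≡⟨ cong₂ (λ u v → δ q y * u + v) (occ-∷ʳ-∷ʳ qs c ys x) (occ-∷ʳ-∷ʳ (q ∷ qs) c ys x) ⟩
  δ q y * (δ c x * occ qs ys + occ (qs ∷ʳ c) ys) + (δ c x * occ (q ∷ qs) ys + occ (q ∷ qs ∷ʳ c) ys)
    ≡⟨ exchange (δ q y) (δ c x) (occ qs ys) (occ (qs ∷ʳ c) ys) (occ (q ∷ qs) ys) (occ (q ∷ qs ∷ʳ c) ys) ⟩
  δ c x * (δ q y * occ qs ys + occ (q ∷ qs) ys) + (δ q y * occ (qs ∷ʳ c) ys + occ (q ∷ qs ∷ʳ c) ys)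
    ≡⟨ cong₂ (λ u v → δ c x * u + v) (occ-∷-∷ q qs y ys) (occ-∷-∷ q (qs ∷ʳ c) y ys) ⟨
  δ c x * occ (q ∷ qs) (y ∷ ys) + occ (q ∷ qs ∷ʳ c) (y ∷ ys)
    ∎
  where
  open ≡-Reasoning
  exchange : ∀ a b u v w z → a * (b * u + v) + (b * w + z) ≡ b * (a * u + w) + (a * v + z)
  exchange = solve-∀

occ-short : ∀ p xs → length xs < length p → occ p xs ≡ 0
occ-short (q ∷ ps) []       _       = refl
occ-short (q ∷ ps) (y ∷ ys) (s≤s h)
  rewrite occ-∷-∷ q ps y ys | occ-short ps ys h | *-zeroʳ (δ q y) = occ-short (q ∷ ps) ys (m<n⇒m<1+n h)

patS≡patE∷ʳtrue : ∀ j → patS j ≡ patE j ∷ʳ true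
patS≡patE∷ʳtrue zero    = refl
patS≡patE∷ʳtrue (suc j) = cong (λ p → true ∷ false ∷ p) (patS≡patE∷ʳtrue j)

patE-suc≡patS∷ʳfalse : ∀ j → patE (suc j) ≡ patS j ∷ʳ false
patE-suc≡patS∷ʳfalse zero    = refl
patE-suc≡patS∷ʳfalse (suc j) = cong (λ p → true ∷ false ∷ p) (patE-suc≡patS∷ʳfalse j)

j≤∣patS∣ : ∀ j → j ≤ length (patS j)
j≤∣patS∣ zero    = z≤n
j≤∣patS∣ (suc j) = s≤s (m≤n⇒m≤1+n (j≤∣patS∣ j))

j≤∣patE∣ : ∀ j → j ≤ length (patE j)
j≤∣patE∣ zero    = z≤n
j≤∣patE∣ (suc j) = s≤s (m≤n⇒m≤1+n (j≤∣patE∣ j))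

occ-patS-∷ʳ-true : ∀ j xs → occ (patS j) (xs ∷ʳ true) ≡ occ (patS j) xs + occ (patE j) xs
occ-patS-∷ʳ-true j xs rewrite patS≡patE∷ʳtrue j =
  trans (occ-∷ʳ-∷ʳ (patE j) true xs true)
        (trans (cong (_+ occ (patE j ∷ʳ true) xs) (*-identityˡ _)) (+-comm (occ (patE j) xs) _))

occ-patS-∷ʳ-false : ∀ j xs → occ (patS j) (xs ∷ʳ false) ≡ occ (patS j) xs
occ-patS-∷ʳ-false j xs rewrite patS≡patE∷ʳtrue j = occ-∷ʳ-∷ʳ (patE j) true xs false

occ-patE-suc-∷ʳ-true : ∀ j xs → occ (patE (suc j)) (xs ∷ʳ true) ≡ occ (patE (suc j)) xs
occ-patE-suc-∷ʳ-true j xs rewrite patE-suc≡patS∷ʳfalse j = occ-∷ʳ-∷ʳ (patS j) false xs true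

occ-patE-suc-∷ʳ-false : ∀ j xs →
  occ (patE (suc j)) (xs ∷ʳ false) ≡ occ (patS j) xs + occ (patE (suc j)) xs
occ-patE-suc-∷ʳ-false j xs rewrite patE-suc≡patS∷ʳfalse j =
  trans (occ-∷ʳ-∷ʳ (patS j) false xs false) (cong (_+ occ (patS j ∷ʳ false) xs) (*-identityˡ _))

-- Coefficient lists

-- _≈_ unfolds to a family of coefficient equations, from which unification cannot
-- recover the polynomials; this wrapper keeps them visible to inference.
infix 4 _≋_ _≋ᶻ_
record _≋_ (p q : Poly) : Set where
  constructor ≈⇒≋
  field ≋⇒≈ : p ≈ q
open _≋_

record _≋ᶻ_ (p q : PolyZ) : Set where
  constructor ≈ᶻ⇒≋ᶻ
  field ≋ᶻ⇒≈ᶻ : p ≈ᶻ q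
open _≋ᶻ_

≋-setoid : Setoid 0ℓ 0ℓ
≋-setoid = record
  { Carrier = Poly ; _≈_ = _≋_
  ; isEquivalence = record
    { refl  = ≈⇒≋ (λ _ → refl)
    ; sym   = λ (≈⇒≋ p≈q) → ≈⇒≋ (λ j → sym (p≈q j))
    ; trans = λ (≈⇒≋ p≈q) (≈⇒≋ q≈r) → ≈⇒≋ (λ j → trans (p≈q j) (q≈r j)) } }

≋ᶻ-setoid : Setoid 0ℓ 0ℓ
≋ᶻ-setoid = record
  { Carrier = PolyZ ; _≈_ = _≋ᶻ_
  ; isEquivalence = record
    { refl  = ≈ᶻ⇒≋ᶻ (λ _ → refl)
    ; sym   = λ (≈ᶻ⇒≋ᶻ p≈q) → ≈ᶻ⇒≋ᶻ (λ j → sym (p≈q j))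
    ; trans = λ (≈ᶻ⇒≋ᶻ p≈q) (≈ᶻ⇒≋ᶻ q≈r) → ≈ᶻ⇒≋ᶻ (λ j → trans (p≈q j) (q≈r j)) } }

open Setoid ≋-setoid using () renaming (refl to ≋-refl; sym to ≋-sym; trans to ≋-trans; reflexive to ≋-reflexive)
open Setoid ≋ᶻ-setoid using () renaming (refl to ≋ᶻ-refl)
module ≋-Reasoning = SetoidReasoning ≋-setoid
module ≋ᶻ-Reasoning = SetoidReasoning ≋ᶻ-setoid

coeff-⊕ : ∀ p q j → coeff (p ⊕ q) j ≡ coeff p j + coeff q j
coeff-⊕ []      q       j       = refl
coeff-⊕ (a ∷ p) []      j       = sym (+-identityʳ _)
coeff-⊕ (a ∷ p) (b ∷ q) zero    = refl
coeff-⊕ (a ∷ p) (b ∷ q) (suc j) = coeff-⊕ p q j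

⊕-cong : ∀ {p p′ q q′} → p ≋ p′ → q ≋ q′ → p ⊕ q ≋ p′ ⊕ q′
⊕-cong {p} {p′} {q} {q′} (≈⇒≋ p≈p′) (≈⇒≋ q≈q′) = ≈⇒≋ λ j →
  trans (coeff-⊕ p q j) (trans (cong₂ _+_ (p≈p′ j) (q≈q′ j)) (sym (coeff-⊕ p′ q′ j)))

x⊕yz≋y⊕xz : ∀ p q r → p ⊕ (q ⊕ r) ≋ q ⊕ (p ⊕ r)
x⊕yz≋y⊕xz p q r = ≈⇒≋ λ j → begin
  coeff (p ⊕ (q ⊕ r)) j                 ≡⟨ trans (coeff-⊕ p _ j) (cong (coeff p j +_) (coeff-⊕ q r j)) ⟩
  coeff p j + (coeff q j + coeff r j)   ≡⟨ x∙yz≈y∙xz (coeff p j) (coeff q j) (coeff r j) ⟩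
  coeff q j + (coeff p j + coeff r j)   ≡⟨ trans (coeff-⊕ q _ j) (cong (coeff q j +_) (coeff-⊕ p r j)) ⟨
  coeff (q ⊕ (p ⊕ r)) j                 ∎
  where open ≡-Reasoning

w·-cong : ∀ {p q} → p ≋ q → w· p ≋ w· q
w·-cong (≈⇒≋ p≈q) = ≈⇒≋ λ { zero → refl ; (suc j) → p≈q j }

eval1-⊕ : ∀ p q → eval1 (p ⊕ q) ≡ eval1 p + eval1 q
eval1-⊕ []      q       = refl
eval1-⊕ (a ∷ p) []      = sym (+-identityʳ _)
eval1-⊕ (a ∷ p) (b ∷ q) = trans (cong (a + b +_) (eval1-⊕ p q)) (interchange a b (sum p) (sum q))

eval1-cong : ∀ {p q} → p ≋ q → eval1 p ≡ eval1 q
eval1-cong {[]}    {[]}    _          = refl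
eval1-cong {[]}    {b ∷ q} (≈⇒≋ p≈q) = cong₂ _+_ (p≈q 0) (eval1-cong {[]} {q} (≈⇒≋ (p≈q ∘ suc)))
eval1-cong {a ∷ p} {[]}    (≈⇒≋ p≈q) = cong₂ _+_ (p≈q 0) (eval1-cong {p} {[]} (≈⇒≋ (p≈q ∘ suc)))
eval1-cong {a ∷ p} {b ∷ q} (≈⇒≋ p≈q) = cong₂ _+_ (p≈q 0) (eval1-cong {p} {q} (≈⇒≋ (p≈q ∘ suc)))

coeffZ-toZ : ∀ p j → coeffZ (toZ p) j ≡ ℤ.+ coeff p j
coeffZ-toZ []      j       = refl
coeffZ-toZ (a ∷ p) zero    = refl
coeffZ-toZ (a ∷ p) (suc j) = coeffZ-toZ p j

coeffZ-⊕ᶻ : ∀ p q j → coeffZ (p ⊕ᶻ q) j ≡ coeffZ p j ℤ.+ coeffZ q j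
coeffZ-⊕ᶻ []      q       j       = sym (ℤₚ.+-identityˡ _)
coeffZ-⊕ᶻ (a ∷ p) []      j       = sym (ℤₚ.+-identityʳ _)
coeffZ-⊕ᶻ (a ∷ p) (b ∷ q) zero    = refl
coeffZ-⊕ᶻ (a ∷ p) (b ∷ q) (suc j) = coeffZ-⊕ᶻ p q j

coeffZ-negᶻ : ∀ p j → coeffZ (negᶻ p) j ≡ ℤ.- coeffZ p j
coeffZ-negᶻ []      j       = refl
coeffZ-negᶻ (a ∷ p) zero    = refl
coeffZ-negᶻ (a ∷ p) (suc j) = coeffZ-negᶻ p j

coeffZ-[w-1]· : ∀ p j → coeffZ ([w-1]· p) j ≡ coeffZ (ℤ.+ 0 ∷ p) j ℤ.- coeffZ p j
coeffZ-[w-1]· p j = trans (coeffZ-⊕ᶻ (ℤ.+ 0 ∷ p) (negᶻ p) j) (cong (ℤ._+_ (coeffZ (ℤ.+ 0 ∷ p) j)) (coeffZ-negᶻ p j))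

toZ-cong : ∀ {p q} → p ≋ q → toZ p ≋ᶻ toZ q
toZ-cong {p} {q} (≈⇒≋ p≈q) = ≈ᶻ⇒≋ᶻ λ j →
  trans (coeffZ-toZ p j) (trans (cong ℤ.+_ (p≈q j)) (sym (coeffZ-toZ q j)))

toZ-injective : ∀ {p q} → toZ p ≋ᶻ toZ q → p ≋ q
toZ-injective {p} {q} (≈ᶻ⇒≋ᶻ p≈q) = ≈⇒≋ λ j →
  ℤₚ.+-injective (trans (sym (coeffZ-toZ p j)) (trans (p≈q j) (coeffZ-toZ q j)))

⊕ᶻ-cong : ∀ {p p′ q q′} → p ≋ᶻ p′ → q ≋ᶻ q′ → p ⊕ᶻ q ≋ᶻ p′ ⊕ᶻ q′
⊕ᶻ-cong {p} {p′} {q} {q′} (≈ᶻ⇒≋ᶻ p≈p′) (≈ᶻ⇒≋ᶻ q≈q′) = ≈ᶻ⇒≋ᶻ λ j →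
  trans (coeffZ-⊕ᶻ p q j) (trans (cong₂ ℤ._+_ (p≈p′ j) (q≈q′ j)) (sym (coeffZ-⊕ᶻ p′ q′ j)))

negᶻ-cong : ∀ {p q} → p ≋ᶻ q → negᶻ p ≋ᶻ negᶻ q
negᶻ-cong {p} {q} (≈ᶻ⇒≋ᶻ p≈q) = ≈ᶻ⇒≋ᶻ λ j →
  trans (coeffZ-negᶻ p j) (trans (cong ℤ.-_ (p≈q j)) (sym (coeffZ-negᶻ q j)))

[w-1]·-cong : ∀ {p q} → p ≋ᶻ q → [w-1]· p ≋ᶻ [w-1]· q
[w-1]·-cong p≋q@(≈ᶻ⇒≋ᶻ p≈q) = ⊕ᶻ-cong (≈ᶻ⇒≋ᶻ λ { zero → refl ; (suc j) → p≈q j }) (negᶻ-cong p≋q)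

a+[ws+e]≋a+[s+e]+[w-1]s : ∀ a s e →
  toZ (a ⊕ (w· s ⊕ e)) ≋ᶻ toZ a ⊕ᶻ toZ (s ⊕ e) ⊕ᶻ [w-1]· (toZ s)
a+[ws+e]≋a+[s+e]+[w-1]s a s e = ≈ᶻ⇒≋ᶻ coefficient
  where
  coefficient : ∀ j → coeffZ (toZ (a ⊕ (w· s ⊕ e))) j ≡ coeffZ (toZ a ⊕ᶻ toZ (s ⊕ e) ⊕ᶻ [w-1]· (toZ s)) j
  coefficient j = begin
    coeffZ (toZ (a ⊕ (w· s ⊕ e))) j                      ≡⟨ lhs ⟩
    ℤ.+ A ℤ.+ (ℤ.+ W ℤ.+ ℤ.+ E)                         ≡⟨ regroup (ℤ.+ A) (ℤ.+ Σ) (ℤ.+ W) (ℤ.+ E) ⟩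
    ℤ.+ A ℤ.+ (ℤ.+ Σ ℤ.+ ℤ.+ E) ℤ.+ (ℤ.+ W ℤ.- ℤ.+ Σ)    ≡⟨ cong₂ ℤ._+_ left right ⟨
    coeffZ (toZ a ⊕ᶻ toZ (s ⊕ e)) j ℤ.+ coeffZ ([w-1]· (toZ s)) j
                                                         ≡⟨ coeffZ-⊕ᶻ (toZ a ⊕ᶻ toZ (s ⊕ e)) _ j ⟨
    coeffZ (toZ a ⊕ᶻ toZ (s ⊕ e) ⊕ᶻ [w-1]· (toZ s)) j     ∎
    where
    open ≡-Reasoning
    A Σ W E : ℕ
    A = coeff a j
    Σ = coeff s j
    W = coeff (w· s) j
    E = coeff e j
    coeffZ-toZ-⊕ : ∀ p q → coeffZ (toZ (p ⊕ q)) j ≡ ℤ.+ coeff p j ℤ.+ ℤ.+ coeff q j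
    coeffZ-toZ-⊕ p q =
      trans (coeffZ-toZ (p ⊕ q) j) (trans (cong ℤ.+_ (coeff-⊕ p q j)) (ℤₚ.pos-+ (coeff p j) (coeff q j)))
    lhs : coeffZ (toZ (a ⊕ (w· s ⊕ e))) j ≡ ℤ.+ A ℤ.+ (ℤ.+ W ℤ.+ ℤ.+ E)
    lhs = trans (coeffZ-toZ-⊕ a (w· s ⊕ e))
                (cong (ℤ._+_ (ℤ.+ A)) (trans (cong ℤ.+_ (coeff-⊕ (w· s) e j)) (ℤₚ.pos-+ W E)))
    left : coeffZ (toZ a ⊕ᶻ toZ (s ⊕ e)) j ≡ ℤ.+ A ℤ.+ (ℤ.+ Σ ℤ.+ ℤ.+ E)
    left = trans (coeffZ-⊕ᶻ (toZ a) (toZ (s ⊕ e)) j) (cong₂ ℤ._+_ (coeffZ-toZ a j) (coeffZ-toZ-⊕ s e))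
    right : coeffZ ([w-1]· (toZ s)) j ≡ ℤ.+ W ℤ.- ℤ.+ Σ
    right = trans (coeffZ-[w-1]· (toZ s) j) (cong₂ ℤ._-_ (coeffZ-toZ (w· s) j) (coeffZ-toZ s j))
    regroup : ∀ a s w e → a ℤ.+ (w ℤ.+ e) ≡ a ℤ.+ (s ℤ.+ e) ℤ.+ (w ℤ.- s)
    regroup = ℤ-Solver.solve-∀

-- Generating polynomials of words

Sʷ Eʷ : List Bool → Poly
Sʷ xs = map (λ j → occ (patS j) xs) (upTo (suc (length xs)))
Eʷ xs = map (λ j → occ (patE j) xs) (upTo (suc (length xs)))

coeff-applyUpTo : ∀ f k j → j < k → coeff (applyUpTo f k) j ≡ f j
coeff-applyUpTo f (suc k) zero    _         = refl
coeff-applyUpTo f (suc k) (suc j) (s≤s j<k) = coeff-applyUpTo (f ∘ suc) k j j<k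

coeff-applyUpTo-≥ : ∀ f k j → k ≤ j → coeff (applyUpTo f k) j ≡ 0
coeff-applyUpTo-≥ f zero    j       _         = refl
coeff-applyUpTo-≥ f (suc k) (suc j) (s≤s k≤j) = coeff-applyUpTo-≥ (f ∘ suc) k j k≤j

-- Truncating the table at the length of the word loses nothing, since longer patterns never occur.
coeff-occTable : ∀ (pat : ℕ → List Bool) → (∀ j → j ≤ length (pat j)) → ∀ xs j →
  coeff (map (λ i → occ (pat i) xs) (upTo (suc (length xs)))) j ≡ occ (pat j) xs
coeff-occTable pat j≤∣pat∣ xs j
  rewrite map-upTo (λ i → occ (pat i) xs) (suc (length xs)) with ≤-<-connex (suc (length xs)) j
... | inj₂ j<k = coeff-applyUpTo (λ i → occ (pat i) xs) (suc (length xs)) j j<k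
... | inj₁ k≤j = trans (coeff-applyUpTo-≥ (λ i → occ (pat i) xs) (suc (length xs)) j k≤j)
                       (sym (occ-short (pat j) xs (≤-trans k≤j (j≤∣pat∣ j))))

coeff-Sʷ : ∀ xs j → coeff (Sʷ xs) j ≡ occ (patS j) xs
coeff-Sʷ = coeff-occTable patS j≤∣patS∣

coeff-Eʷ : ∀ xs j → coeff (Eʷ xs) j ≡ occ (patE j) xs
coeff-Eʷ = coeff-occTable patE j≤∣patE∣

Sʷ-∷ʳ-true : ∀ xs → Sʷ (xs ∷ʳ true) ≋ Sʷ xs ⊕ Eʷ xs
Sʷ-∷ʳ-true xs = ≈⇒≋ λ j → begin
  coeff (Sʷ (xs ∷ʳ true)) j               ≡⟨ coeff-Sʷ (xs ∷ʳ true) j ⟩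
  occ (patS j) (xs ∷ʳ true)               ≡⟨ occ-patS-∷ʳ-true j xs ⟩
  occ (patS j) xs + occ (patE j) xs       ≡⟨ cong₂ _+_ (coeff-Sʷ xs j) (coeff-Eʷ xs j) ⟨
  coeff (Sʷ xs) j + coeff (Eʷ xs) j       ≡⟨ coeff-⊕ (Sʷ xs) (Eʷ xs) j ⟨
  coeff (Sʷ xs ⊕ Eʷ xs) j                 ∎
  where open ≡-Reasoning

Sʷ-∷ʳ-false : ∀ xs → Sʷ (xs ∷ʳ false) ≋ Sʷ xs
Sʷ-∷ʳ-false xs = ≈⇒≋ λ j →
  trans (coeff-Sʷ (xs ∷ʳ false) j) (trans (occ-patS-∷ʳ-false j xs) (sym (coeff-Sʷ xs j)))

Eʷ-∷ʳ-true : ∀ xs → Eʷ (xs ∷ʳ true) ≋ Eʷ xs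
Eʷ-∷ʳ-true xs = ≈⇒≋ λ where
  zero    → trans (coeff-Eʷ (xs ∷ʳ true) 0) (sym (coeff-Eʷ xs 0))
  (suc j) → trans (coeff-Eʷ (xs ∷ʳ true) (suc j))
                  (trans (occ-patE-suc-∷ʳ-true j xs) (sym (coeff-Eʷ xs (suc j))))

Eʷ-∷ʳ-false : ∀ xs → Eʷ (xs ∷ʳ false) ≋ w· (Sʷ xs) ⊕ Eʷ xs
Eʷ-∷ʳ-false xs = ≈⇒≋ coefficient
  where
  open ≡-Reasoning
  coefficient : ∀ j → coeff (Eʷ (xs ∷ʳ false)) j ≡ coeff (w· (Sʷ xs) ⊕ Eʷ xs) j
  coefficient zero = trans (coeff-Eʷ (xs ∷ʳ false) 0)
                           (sym (trans (coeff-⊕ (w· (Sʷ xs)) (Eʷ xs) 0) (coeff-Eʷ xs 0)))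
  coefficient (suc j) = begin
    coeff (Eʷ (xs ∷ʳ false)) (suc j)           ≡⟨ coeff-Eʷ (xs ∷ʳ false) (suc j) ⟩
    occ (patE (suc j)) (xs ∷ʳ false)           ≡⟨ occ-patE-suc-∷ʳ-false j xs ⟩
    occ (patS j) xs + occ (patE (suc j)) xs    ≡⟨ cong₂ _+_ (coeff-Sʷ xs j) (coeff-Eʷ xs (suc j)) ⟨
    coeff (Sʷ xs) j + coeff (Eʷ xs) (suc j)    ≡⟨ coeff-⊕ (w· (Sʷ xs)) (Eʷ xs) (suc j) ⟨
    coeff (w· (Sʷ xs) ⊕ Eʷ xs) (suc j)         ∎

-- Binary expansions

binaryF-fuel-irrelevant : ∀ f g n → n ≤ f → n ≤ g → binaryF f n ≡ binaryF g n
binaryF-fuel-irrelevant zero    zero    zero    _       _       = refl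
binaryF-fuel-irrelevant zero    (suc g) zero    _       _       = refl
binaryF-fuel-irrelevant (suc f) zero    zero    _       _       = refl
binaryF-fuel-irrelevant (suc f) (suc g) zero    _       _       = refl
binaryF-fuel-irrelevant (suc f) (suc g) (suc n) (s≤s n≤f) (s≤s n≤g) =
  cong (_∷ʳ (suc n % 2 ≡ᵇ 1))
       (binaryF-fuel-irrelevant f g ⌊ suc n /2⌋ (≤-trans half≤n n≤f) (≤-trans half≤n n≤g))
  where
  half≤n : ⌊ suc n /2⌋ ≤ n
  half≤n = s≤s⁻¹ (⌊n/2⌋<n n)

binary-suc : ∀ n → binary (suc n) ≡ binary ⌊ suc n /2⌋ ∷ʳ (suc n % 2 ≡ᵇ 1)
binary-suc n = cong (_∷ʳ (suc n % 2 ≡ᵇ 1))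
  (binaryF-fuel-irrelevant n ⌊ suc n /2⌋ ⌊ suc n /2⌋ (s≤s⁻¹ (⌊n/2⌋<n n)) ≤-refl)

⌊2n/2⌋≡n : ∀ n → ⌊ 2 * n /2⌋ ≡ n
⌊2n/2⌋≡n n = sym (trans (n≡⌊n+n/2⌋ n) (cong (λ m → ⌊ n + m /2⌋) (sym (+-identityʳ n))))

⌊1+2n/2⌋≡n : ∀ n → ⌊ suc (2 * n) /2⌋ ≡ n
⌊1+2n/2⌋≡n zero    = refl
⌊1+2n/2⌋≡n (suc n) = cong suc (trans (cong ⌊_/2⌋ (+-suc n (n + 0))) (⌊1+2n/2⌋≡n n))

binary-2n+1 : ∀ n → binary (2 * n + 1) ≡ binary n ∷ʳ true
binary-2n+1 n = begin
  binary (2 * n + 1)                                       ≡⟨ cong binary (+-comm (2 * n) 1) ⟩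
  binary (suc (2 * n))                                     ≡⟨ binary-suc (2 * n) ⟩
  binary ⌊ suc (2 * n) /2⌋ ∷ʳ (suc (2 * n) % 2 ≡ᵇ 1)       ≡⟨ cong₂ (λ m b → binary m ∷ʳ (b ≡ᵇ 1)) (⌊1+2n/2⌋≡n n) 1+2n%2≡1 ⟩
  binary n ∷ʳ true                                         ∎
  where
  open ≡-Reasoning
  1+2n%2≡1 : suc (2 * n) % 2 ≡ 1
  1+2n%2≡1 = trans (cong (λ m → suc m % 2) (*-comm 2 n)) ([m+kn]%n≡m%n 1 n 2)

binary-2[1+n] : ∀ n → binary (2 * suc n) ≡ binary (suc n) ∷ʳ false
binary-2[1+n] n = begin
  binary (2 * suc n)                                      ≡⟨ binary-suc (n + suc (n + 0)) ⟩
  binary ⌊ 2 * suc n /2⌋ ∷ʳ (2 * suc n % 2 ≡ᵇ 1)          ≡⟨ cong₂ (λ m b → binary m ∷ʳ (b ≡ᵇ 1)) (⌊2n/2⌋≡n (suc n)) 2n%2≡0 ⟩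
  binary (suc n) ∷ʳ false                                 ∎
  where
  open ≡-Reasoning
  2n%2≡0 : 2 * suc n % 2 ≡ 0
  2n%2≡0 = trans (cong (_% 2) (*-comm 2 (suc n))) (m*n%n≡0 (suc n) 2)

-- The system (ii)

S-0 : S 0 ≋ []
S-0 = ≈⇒≋ λ { zero → refl ; (suc j) → refl }

S-1 : S 1 ≋ 1 ∷ []
S-1 = ≈⇒≋ λ { zero → refl ; (suc zero) → refl ; (suc (suc j)) → refl }

Se-0 : Se 0 ≋ 1 ∷ []
Se-0 = ≈⇒≋ λ { zero → refl ; (suc j) → refl }

Se-1 : Se 1 ≋ 1 ∷ []
Se-1 = ≈⇒≋ λ { zero → refl ; (suc zero) → refl ; (suc (suc j)) → refl }

S-2n : ∀ n → S (2 * n) ≋ S n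
S-2n zero    = ≋-refl
S-2n (suc n) = ≋-trans (≋-reflexive (cong Sʷ (binary-2[1+n] n))) (Sʷ-∷ʳ-false (binary (suc n)))

S-2n+1 : ∀ n → S (2 * n + 1) ≋ S n ⊕ Se n
S-2n+1 n = ≋-trans (≋-reflexive (cong Sʷ (binary-2n+1 n))) (Sʷ-∷ʳ-true (binary n))

Se-2n : ∀ n → Se (2 * n) ≋ w· (S n) ⊕ Se n
Se-2n zero    = ≈⇒≋ λ { zero → refl ; (suc zero) → refl ; (suc (suc j)) → refl }
Se-2n (suc n) = ≋-trans (≋-reflexive (cong Eʷ (binary-2[1+n] n))) (Eʷ-∷ʳ-false (binary (suc n)))

Se-2n+1 : ∀ n → Se (2 * n + 1) ≋ Se n
Se-2n+1 n = ≋-trans (≋-reflexive (cong Eʷ (binary-2n+1 n))) (Eʷ-∷ʳ-true (binary n))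

S-Rec2 : Rec2 S Se
S-Rec2 = ≋⇒≈ S-0 , ≋⇒≈ S-1 , ≋⇒≈ Se-0 , ≋⇒≈ Se-1
       , ≋⇒≈ ∘ S-2n , ≋⇒≈ ∘ S-2n+1 , ≋⇒≈ ∘ Se-2n , ≋⇒≈ ∘ Se-2n+1

data Parity : ℕ → Set where
  even : ∀ k → Parity (2 * k)
  odd  : ∀ k → Parity (2 * k + 1)

parity : ∀ n → Parity n
parity zero = even 0
parity (suc n) with parity n
... | even k = subst Parity (+-comm (2 * k) 1) (odd k)
... | odd k  = subst Parity (trans (*-suc 2 k) (cong suc (+-comm 1 (2 * k)))) (even (suc k))

n<2*n+1 : ∀ n → n < 2 * n + 1
n<2*n+1 n = ≤-<-trans (m≤m+n n (n + 0)) (m<m+n (2 * n) z<s)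

binary-induction : (P : ℕ → Set) → P 0 →
  (∀ n → P n → P (2 * n)) → (∀ n → P n → P (2 * n + 1)) → ∀ n → P n
binary-induction P P0 P2n P2n+1 = <-rec P step
  where
  step : ∀ n → (∀ {m} → m < n → P m) → P n
  step n below with parity n
  ... | even zero    = P0
  ... | even (suc k) = P2n (suc k) (below (m<m+n (suc k) z<s))
  ... | odd k        = P2n+1 k (below (n<2*n+1 k))

-- The prescribed values T 1 and Te 1 are not needed: the equations at n = 0 force them.
Rec2-unique : ∀ T Te → Rec2 T Te → ∀ n → T n ≋ S n × Te n ≋ Se n
Rec2-unique T Te (T0 , _ , Te0 , _ , T2n , T2n+1 , Te2n , Te2n+1) =
  binary-induction (λ n → T n ≋ S n × Te n ≋ Se n) base double double+1
  where
  open ≋-Reasoning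
  base : T 0 ≋ S 0 × Te 0 ≋ Se 0
  base = ≋-trans (≈⇒≋ T0) (≋-sym S-0) , ≋-trans (≈⇒≋ Te0) (≋-sym Se-0)
  double : ∀ n → T n ≋ S n × Te n ≋ Se n → T (2 * n) ≋ S (2 * n) × Te (2 * n) ≋ Se (2 * n)
  double n (T≋S , Te≋Se) =
    (begin T (2 * n)            ≈⟨ ≈⇒≋ (T2n n) ⟩
           T n                  ≈⟨ T≋S ⟩
           S n                  ≈⟨ S-2n n ⟨
           S (2 * n)            ∎) ,
    (begin Te (2 * n)           ≈⟨ ≈⇒≋ (Te2n n) ⟩
           w· (T n) ⊕ Te n      ≈⟨ ⊕-cong (w·-cong T≋S) Te≋Se ⟩
           w· (S n) ⊕ Se n      ≈⟨ Se-2n n ⟨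
           Se (2 * n)           ∎)
  double+1 : ∀ n → T n ≋ S n × Te n ≋ Se n → T (2 * n + 1) ≋ S (2 * n + 1) × Te (2 * n + 1) ≋ Se (2 * n + 1)
  double+1 n (T≋S , Te≋Se) =
    (begin T (2 * n + 1)        ≈⟨ ≈⇒≋ (T2n+1 n) ⟩
           T n ⊕ Te n           ≈⟨ ⊕-cong T≋S Te≋Se ⟩
           S n ⊕ Se n           ≈⟨ S-2n+1 n ⟨
           S (2 * n + 1)        ∎) ,
    (begin Te (2 * n + 1)       ≈⟨ ≈⇒≋ (Te2n+1 n) ⟩
           Te n                 ≈⟨ Te≋Se ⟩
           Se n                 ≈⟨ Se-2n+1 n ⟨
           Se (2 * n + 1)       ∎)

-- Evaluation at w = 1

S-eval1-Stern : (s : ℕ → ℕ) → IsStern s → ∀ n → eval1 (S n) ≡ s n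
S-eval1-Stern s (s0 , s1 , s-even , s-odd) n = proj₁ (binary-induction P base double double+1 n)
  where
  open ≡-Reasoning
  P : ℕ → Set
  P n = eval1 (S n) ≡ s n × eval1 (Se n) ≡ s (n + 1)
  base : P 0
  base = sym s0 , sym s1
  double : ∀ n → P n → P (2 * n)
  double zero      P0             = P0
  double n@(suc _) (S≡s , Se≡s) =
    trans (eval1-cong (S-2n n)) (trans S≡s (sym (s-even n (s≤s z≤n)))) ,
    (begin
      eval1 (Se (2 * n))                ≡⟨ eval1-cong (Se-2n n) ⟩
      eval1 (w· (S n) ⊕ Se n)           ≡⟨ eval1-⊕ (w· (S n)) (Se n) ⟩
      eval1 (S n) + eval1 (Se n)        ≡⟨ cong₂ _+_ S≡s Se≡s ⟩
      s n + s (n + 1)                   ≡⟨ s-odd n (s≤s z≤n) ⟨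
      s (2 * n + 1)                     ∎)
  double+1 : ∀ n → P n → P (2 * n + 1)
  double+1 zero      _              = sym s1 , trans (sym s1) (sym (s-even 1 (s≤s z≤n)))
  double+1 n@(suc _) (S≡s , Se≡s) =
    (begin
      eval1 (S (2 * n + 1))             ≡⟨ eval1-cong (S-2n+1 n) ⟩
      eval1 (S n ⊕ Se n)                ≡⟨ eval1-⊕ (S n) (Se n) ⟩
      eval1 (S n) + eval1 (Se n)        ≡⟨ cong₂ _+_ S≡s Se≡s ⟩
      s n + s (n + 1)                   ≡⟨ s-odd n (s≤s z≤n) ⟨
      s (2 * n + 1)                     ∎) ,
    (begin
      eval1 (Se (2 * n + 1))            ≡⟨ eval1-cong (Se-2n+1 n) ⟩
      eval1 (Se n)                      ≡⟨ Se≡s ⟩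
      s (n + 1)                         ≡⟨ s-even (n + 1) (m≤n+m 1 n) ⟨
      s (2 * (n + 1))                   ≡⟨ cong s (trans (*-distribˡ-+ 2 n 1) (sym (+-assoc (2 * n) 1 1))) ⟩
      s (2 * n + 1 + 1)                 ∎)

-- The recursion (iii)

S-4n+1 : ∀ n → S (4 * n + 1) ≋ w· (S (2 * n)) ⊕ S (2 * n + 1)
S-4n+1 n = begin
  S (4 * n + 1)                    ≡⟨ cong (λ m → S (m + 1)) (*-assoc 2 2 n) ⟩
  S (2 * (2 * n) + 1)              ≈⟨ S-2n+1 (2 * n) ⟩
  S (2 * n) ⊕ Se (2 * n)           ≈⟨ ⊕-cong (S-2n n) (Se-2n n) ⟩
  S n ⊕ (w· (S n) ⊕ Se n)          ≈⟨ x⊕yz≋y⊕xz (S n) (w· (S n)) (Se n) ⟩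
  w· (S n) ⊕ (S n ⊕ Se n)          ≈⟨ ⊕-cong (w·-cong (S-2n n)) (S-2n+1 n) ⟨
  w· (S (2 * n)) ⊕ S (2 * n + 1)   ∎
  where open ≋-Reasoning

2^a*[x+1]>0 : ∀ a x → 0 < 2 ^ a * (x + 1)
2^a*[x+1]>0 a x = *-mono-≤ (m^n>0 2 a) (m≤n+m 1 x)

2*n∸1≡2*[n∸1]+1 : ∀ n → 0 < n → 2 * n ∸ 1 ≡ 2 * (n ∸ 1) + 1
2*n∸1≡2*[n∸1]+1 (suc n) _ = trans (cong (_∸ 1) (*-suc 2 n)) (+-comm 1 (2 * n))

4*n∸1≡2*[2*n∸1]+1 : ∀ n → 0 < n → 4 * n ∸ 1 ≡ 2 * (2 * n ∸ 1) + 1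
4*n∸1≡2*[2*n∸1]+1 n n>0 =
  trans (cong (_∸ 1) (*-assoc 2 2 n)) (2*n∸1≡2*[n∸1]+1 (2 * n) (≤-trans n>0 (m≤m+n n (n + 0))))

-- 2^a (x + 1) - 1 is x followed by a ones, and trailing ones do not change Se.
Se-2^a*[x+1]∸1 : ∀ a x → Se (2 ^ a * (x + 1) ∸ 1) ≋ Se x
Se-2^a*[x+1]∸1 zero    x = ≋-reflexive (cong Se (trans (cong (_∸ 1) (*-identityˡ (x + 1))) (m+n∸n≡m x 1)))
Se-2^a*[x+1]∸1 (suc a) x = begin
  Se (2 ^ suc a * (x + 1) ∸ 1)     ≡⟨ cong (λ m → Se (m ∸ 1)) (*-assoc 2 (2 ^ a) (x + 1)) ⟩
  Se (2 * N ∸ 1)                   ≡⟨ cong Se (2*n∸1≡2*[n∸1]+1 N (2^a*[x+1]>0 a x)) ⟩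
  Se (2 * (N ∸ 1) + 1)             ≈⟨ Se-2n+1 (N ∸ 1) ⟩
  Se (N ∸ 1)                       ≈⟨ Se-2^a*[x+1]∸1 a x ⟩
  Se x                             ∎
  where
  open ≋-Reasoning
  N : ℕ
  N = 2 ^ a * (x + 1)

Se[2n∸1]≋Se[2m] : ∀ n a m → n ≡ 2 ^ a * (2 * m + 1) → Se (2 * n ∸ 1) ≋ Se (2 * m)
Se[2n∸1]≋Se[2m] n a m n≡ = ≋-trans (≋-reflexive (cong (λ k → Se (k ∸ 1)) 2n≡)) (Se-2^a*[x+1]∸1 (suc a) (2 * m))
  where
  2n≡ : 2 * n ≡ 2 ^ suc a * (2 * m + 1)
  2n≡ = trans (cong (2 *_) n≡) (sym (*-assoc 2 (2 ^ a) (2 * m + 1)))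

S[4n∸1]≋ : ∀ n a m → n ≡ 2 ^ a * (2 * m + 1) → S (4 * n ∸ 1) ≋ S (2 * n ∸ 1) ⊕ (w· (S m) ⊕ Se m)
S[4n∸1]≋ n a m n≡ = begin
  S (4 * n ∸ 1)                        ≡⟨ cong S (4*n∸1≡2*[2*n∸1]+1 n n>0) ⟩
  S (2 * (2 * n ∸ 1) + 1)              ≈⟨ S-2n+1 (2 * n ∸ 1) ⟩
  S (2 * n ∸ 1) ⊕ Se (2 * n ∸ 1)       ≈⟨ ⊕-cong (≋-refl {S (2 * n ∸ 1)}) (≋-trans (Se[2n∸1]≋Se[2m] n a m n≡) (Se-2n m)) ⟩
  S (2 * n ∸ 1) ⊕ (w· (S m) ⊕ Se m)    ∎
  where
  open ≋-Reasoning
  n>0 : 0 < n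
  n>0 = subst (0 <_) (sym n≡) (2^a*[x+1]>0 a (2 * m))

S-4n-1 : ∀ n a m → n ≡ 2 ^ a * (2 * m + 1) →
  toZ (S (4 * n ∸ 1)) ≋ᶻ toZ (S (2 * n ∸ 1)) ⊕ᶻ toZ (S (2 * m + 1)) ⊕ᶻ [w-1]· (toZ (S (2 * m)))
S-4n-1 n a m n≡ = begin
  toZ (S (4 * n ∸ 1))                                            ≈⟨ toZ-cong (S[4n∸1]≋ n a m n≡) ⟩
  toZ (S (2 * n ∸ 1) ⊕ (w· (S m) ⊕ Se m))                        ≈⟨ a+[ws+e]≋a+[s+e]+[w-1]s (S (2 * n ∸ 1)) (S m) (Se m) ⟩
  toZ (S (2 * n ∸ 1)) ⊕ᶻ toZ (S m ⊕ Se m) ⊕ᶻ [w-1]· (toZ (S m))  ≈⟨ ⊕ᶻ-cong (⊕ᶻ-cong (≋ᶻ-refl {toZ (S (2 * n ∸ 1))}) S[2m+1]) [w-1]S[2m] ⟨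
  toZ (S (2 * n ∸ 1)) ⊕ᶻ toZ (S (2 * m + 1)) ⊕ᶻ [w-1]· (toZ (S (2 * m)))  ∎
  where
  open ≋ᶻ-Reasoning
  S[2m+1] : toZ (S (2 * m + 1)) ≋ᶻ toZ (S m ⊕ Se m)
  S[2m+1] = toZ-cong (S-2n+1 m)
  [w-1]S[2m] : [w-1]· (toZ (S (2 * m))) ≋ᶻ [w-1]· (toZ (S m))
  [w-1]S[2m] = [w-1]·-cong (toZ-cong (S-2n m))

S-Rec3 : Rec3 S
S-Rec3 = ≋⇒≈ S-0 , ≋⇒≈ S-1 , ≋⇒≈ ∘ S-2n , ≋⇒≈ ∘ S-4n+1 , λ n a m n≡ → ≋ᶻ⇒≈ᶻ (S-4n-1 n a m n≡)

n≡2^a*[2m+1] : ∀ n → 0 < n → ∃₂ λ a m → n ≡ 2 ^ a * (2 * m + 1)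
n≡2^a*[2m+1] = binary-induction P (λ ()) double double+1
  where
  P : ℕ → Set
  P n = 0 < n → ∃₂ λ a m → n ≡ 2 ^ a * (2 * m + 1)
  double : ∀ n → P n → P (2 * n)
  double zero      _ ()
  double n@(suc _) Pn _ with Pn z<s
  ... | a , m , n≡ = suc a , m , trans (cong (2 *_) n≡) (sym (*-assoc 2 (2 ^ a) (2 * m + 1)))
  double+1 : ∀ n → P n → P (2 * n + 1)
  double+1 n _ _ = 0 , n , sym (*-identityˡ (2 * n + 1))

2*n+1<4*n+1 : ∀ n .{{_ : NonZero n}} → 2 * n + 1 < 4 * n + 1
2*n+1<4*n+1 n = +-monoˡ-< 1 (*-monoˡ-< n {2} {4} (s≤s (s≤s (s≤s z≤n))))

2*n∸1<4*n∸1 : ∀ n .{{_ : NonZero n}} → 2 * n ∸ 1 < 4 * n ∸ 1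
2*n∸1<4*n∸1 n@(suc _) = ∸-monoˡ-< (*-monoˡ-< n {2} {4} (s≤s (s≤s (s≤s z≤n)))) (s≤s z≤n)

n≤2*n∸1 : ∀ n .{{_ : NonZero n}} → n ≤ 2 * n ∸ 1
n≤2*n∸1 (suc n) = subst (suc n ≤_) (sym (+-suc n (n + 0))) (s≤s (m≤m+n n (n + 0)))

data Rec3View : ℕ → Set where
  n=0    : Rec3View 0
  n=1    : Rec3View 1
  n=2k   : ∀ k → Rec3View (2 * suc k)
  n=4k+1 : ∀ k → Rec3View (4 * suc k + 1)
  n=4k-1 : ∀ k → Rec3View (4 * suc k ∸ 1)

rec3View : ∀ n → Rec3View n
rec3View n with parity n
... | even zero    = n=0
... | even (suc k) = n=2k k
... | odd k with parity k
... | even zero    = n=1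
... | even (suc k) = subst Rec3View (cong (_+ 1) (*-assoc 2 2 (suc k))) (n=4k+1 k)
... | odd k        = subst Rec3View 4[1+k]∸1≡2[2k+1]+1 (n=4k-1 k)
  where
  4[1+k]∸1≡2[2k+1]+1 : 4 * suc k ∸ 1 ≡ 2 * (2 * k + 1) + 1
  4[1+k]∸1≡2[2k+1]+1 = trans (4*n∸1≡2*[2*n∸1]+1 (suc k) z<s)
                              (cong (λ x → 2 * x + 1) (2*n∸1≡2*[n∸1]+1 (suc k) z<s))

Rec3-unique : ∀ T → Rec3 T → ∀ n → T n ≋ S n
Rec3-unique T (T0 , T1 , T2n , T4n+1 , T4n-1) = <-rec _ step
  where
  step : ∀ n → (∀ {m} → m < n → T m ≋ S m) → T n ≋ S n
  step n below with rec3View n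
  ... | n=0 = ≋-trans (≈⇒≋ T0) (≋-sym S-0)
  ... | n=1 = ≋-trans (≈⇒≋ T1) (≋-sym S-1)
  ... | n=2k k = begin
    T (2 * suc k)                              ≈⟨ ≈⇒≋ (T2n (suc k)) ⟩
    T (suc k)                                  ≈⟨ below (m<m+n (suc k) z<s) ⟩
    S (suc k)                                  ≈⟨ S-2n (suc k) ⟨
    S (2 * suc k)                              ∎
    where open ≋-Reasoning
  ... | n=4k+1 k = begin
    T (4 * suc k + 1)                          ≈⟨ ≈⇒≋ (T4n+1 (suc k)) ⟩
    w· (T (2 * suc k)) ⊕ T (2 * suc k + 1)     ≈⟨ ⊕-cong (w·-cong (below 2N<4N+1)) (below (2*n+1<4*n+1 (suc k))) ⟩
    w· (S (2 * suc k)) ⊕ S (2 * suc k + 1)     ≈⟨ S-4n+1 (suc k) ⟨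
    S (4 * suc k + 1)                          ∎
    where
    open ≋-Reasoning
    2N<4N+1 : 2 * suc k < 4 * suc k + 1
    2N<4N+1 = <-trans (m<m+n (2 * suc k) z<s) (2*n+1<4*n+1 (suc k))
  ... | n=4k-1 k with n≡2^a*[2m+1] (suc k) z<s
  ... | a , m , 1+k≡ = toZ-injective (begin
    toZ (T (4 * suc k ∸ 1))
      ≈⟨ ≈ᶻ⇒≋ᶻ (T4n-1 (suc k) a m 1+k≡) ⟩
    toZ (T (2 * suc k ∸ 1)) ⊕ᶻ toZ (T (2 * m + 1)) ⊕ᶻ [w-1]· (toZ (T (2 * m)))
      ≈⟨ ⊕ᶻ-cong (⊕ᶻ-cong (toZ-cong (below (2*n∸1<4*n∸1 (suc k)))) (toZ-cong (below 2m+1<n)))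
                 ([w-1]·-cong (toZ-cong (below (<-trans (m<m+n (2 * m) z<s) 2m+1<n)))) ⟩
    toZ (S (2 * suc k ∸ 1)) ⊕ᶻ toZ (S (2 * m + 1)) ⊕ᶻ [w-1]· (toZ (S (2 * m)))
      ≈⟨ S-4n-1 (suc k) a m 1+k≡ ⟨
    toZ (S (4 * suc k ∸ 1))
      ∎)
    where
    open ≋ᶻ-Reasoning
    2m+1≤1+k : 2 * m + 1 ≤ suc k
    2m+1≤1+k = subst (2 * m + 1 ≤_) (sym 1+k≡) (m≤n*m (2 * m + 1) (2 ^ a) {{m^n≢0 2 a}})
    2m+1<n : 2 * m + 1 < 4 * suc k ∸ 1
    2m+1<n = ≤-<-trans (≤-trans 2m+1≤1+k (n≤2*n∸1 (suc k))) (2*n∸1<4*n∸1 (suc k))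

mainTheorem9 : ((s : ℕ → ℕ) → IsStern s → ∀ n → eval1 (S n) ≡ s n)
    × (Rec2 S Se × (∀ T Te → Rec2 T Te → ∀ n → (T n ≈ S n) × (Te n ≈ Se n)))
    × (Rec3 S × (∀ T → Rec3 T → ∀ n → T n ≈ S n))
mainTheorem9 =
    S-eval1-Stern
  , (S-Rec2 , λ T Te rec n → Product.map ≋⇒≈ ≋⇒≈ (Rec2-unique T Te rec n))
  , (S-Rec3 , λ T rec n → ≋⇒≈ (Rec3-unique T rec n))
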